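{- Let $A\in\mathcal A_n$. Then the tree $\tau(A)$ is naturally labeled.
   Context: $K$ is an algebraically closed field. A connected linear Nakayama algebra with $m$ simple modules is $KQ/I$ with $Q$ the linear quiver $0\to1\to\cdots\to m-1$ and $I$ an admissible ideal; its Kupisch series $[c_0,\dots,c_{m-1}]$, $c_i=\dim_K e_iA$, satisfies $c_{i+1}+1\ge c_i\ge 2$ for $0\le i<m-1$ and $c_{m-1}=1$. $\mathcal A_n$ denotes the set of ordered products $A=A_1\times\cdots\times A_k$ ($k\ge1$; order matters) of connected linear Nakayama algebras with $n$ simple modules in total, with Kupisch series $[c_0,\dots,c_{n-1}]$ the concatenation of those of the factors. $\tau(A)$ is the rooted tree with vertex set $\{0,\dots,n\}$, root $n$, in which the parent of $i$ ($0\le i<n$) is $i+c_i$. A rooted tree with vertex set $\{0,\dots,n\}$ is naturally labeled if labels increase towards the root (every vertex has a smaller label than its parent) and, for every $i<n$, the labels of all children of $i$ are smaller than the labels of all children of $i+1$. -}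

module Defs where

open import Data.Nat using (ℕ; zero; suc; _+_; _≤_; _<_)
open import Data.List using (List; []; _∷_; length; concat; lookup)
open import Data.List.Relation.Unary.All using (All)
open import Data.Fin using (Fin; toℕ; cast)
open import Data.Product using (_×_)
open import Relation.Binary.PropositionalEquality using (_≡_; _≢_; sym)

-- Kupisch series [c_0,…,c_{m-1}] (m ≥ 1) of a connected linear Nakayama
-- algebra: c_{m-1} = 1 and, for i < m-1, c_{i+1} + 1 ≥ c_i ≥ 2.
data IsKupisch : List ℕ → Set where
  last : IsKupisch (1 ∷ [])
  step : ∀ {c d cs} → 2 ≤ c → c ≤ d + 1 → IsKupisch (d ∷ cs) → IsKupisch (c ∷ d ∷ cs)

-- An element of 𝒜_n: an ordered, nonempty list of connected linear Nakayama
-- algebras (each recorded by its Kupisch series, which determines it up to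
-- isomorphism) with n simple modules in total.
record 𝒜 (n : ℕ) : Set where
  field
    factors   : List (List ℕ)
    nonempty  : factors ≢ []
    kupisch   : All IsKupisch factors
    total     : length (concat factors) ≡ n

kupischSeries : ∀ {n} → 𝒜 n → Fin n → ℕ
kupischSeries A i = lookup (concat (𝒜.factors A)) (cast (sym (𝒜.total A)) i)

-- τ(A): vertex set {0,…,n}, root n, parent of i < n is i + c_i.
τ-parent : ∀ {n} → 𝒜 n → Fin n → ℕ
τ-parent A i = toℕ i + kupischSeries A i

-- A rooted tree on {0,…,n} with root n, given by its parent map on the
-- non-root vertices, is naturally labeled if the parent map lands in
-- {0,…,n}, labels increase towards the root, and for every i < n every child
-- of i has a smaller label than every child of i+1.
NaturallyLabeled : (n : ℕ) → (Fin n → ℕ) → Set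
NaturallyLabeled n par =
  (∀ (i : Fin n) → toℕ i < par i × par i ≤ n) ×
  (∀ (i : ℕ) → i < n → ∀ (a b : Fin n) → par a ≡ i → par b ≡ suc i → toℕ a < toℕ b)

{-# OPTIONS --safe #-}
-- Concatenating Kupisch series preserves the local conditions c_i ≥ 1 and
-- c_i ≤ c_{i+1} + 1, provided one reads c_n = 0; this is where c = 1 at the
-- end of each factor is used. These conditions say exactly that the parent
-- map i ↦ i + c_i is inflationary, bounded by n and weakly monotone, and a
-- monotone parent map puts every child of i before every child of i + 1.
module Submission where

open import Defs
open import Data.Nat using (ℕ; suc; _+_; _≤_; _<_; z≤n; s≤s)
open import Data.Nat.Properties
  using (≤-refl; ≤-trans; <⇒≤; ≰⇒>; n≮n; +-comm)
open import Data.List using (List; []; _∷_; length; concat; lookup; _++_)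
open import Data.List.Relation.Unary.All using (All; []; _∷_)
open import Data.Fin using (Fin; toℕ; cast) renaming (zero to fzero; suc to fsuc)
open import Data.Fin.Properties using (toℕ-cast)
open import Data.Product using (_×_; _,_)
open import Relation.Binary.PropositionalEquality
  using (_≡_; refl; sym; cong; subst; subst₂)

monotone⇒naturallyLabeled :
  ∀ {n} (par : Fin n → ℕ) →
  (∀ i → toℕ i < par i × par i ≤ n) →
  (∀ a b → toℕ a ≤ toℕ b → par a ≤ par b) →
  NaturallyLabeled n par
monotone⇒naturallyLabeled {n} par bounded monotone = bounded , childrenOrdered
  where
  childrenOrdered : ∀ i → i < n → ∀ a b → par a ≡ i → par b ≡ suc i → toℕ a < toℕ b
  childrenOrdered _ _ a b refl par-b≡1+par-a = ≰⇒> λ b≤a →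
    n≮n (par a) (subst (_≤ par a) par-b≡1+par-a (monotone b a b≤a))

head₀ : List ℕ → ℕ
head₀ []      = 0
head₀ (c ∷ _) = c

-- Kupisch series of products of linear Nakayama algebras (the empty product
-- included); the convention head₀ [] = 0 forces the last entry to be 1.
data IsProductKupisch : List ℕ → Set where
  []   : IsProductKupisch []
  cons : ∀ {c cs} → 1 ≤ c → c ≤ suc (head₀ cs) → IsProductKupisch cs →
         IsProductKupisch (c ∷ cs)

++-isProductKupisch : ∀ {cs ds} → IsKupisch cs → IsProductKupisch ds →
                      IsProductKupisch (cs ++ ds)
++-isProductKupisch last ds = cons (s≤s z≤n) (s≤s z≤n) ds
++-isProductKupisch (step {c} {d} 2≤c c≤d+1 cs) ds =
  cons (<⇒≤ 2≤c) (subst (c ≤_) (+-comm d 1) c≤d+1) (++-isProductKupisch cs ds)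

concat-isProductKupisch : ∀ {css} → All IsKupisch css → IsProductKupisch (concat css)
concat-isProductKupisch []         = []
concat-isProductKupisch (cs ∷ css) =
  ++-isProductKupisch cs (concat-isProductKupisch css)

head₀≤length : ∀ {cs} → IsProductKupisch cs → head₀ cs ≤ length cs
head₀≤length []                = z≤n
head₀≤length (cons _ c≤1+d cs) = ≤-trans c≤1+d (s≤s (head₀≤length cs))

parent : (cs : List ℕ) → Fin (length cs) → ℕ
parent cs i = toℕ i + lookup cs i

parent-inflationary : ∀ {cs} → IsProductKupisch cs → ∀ i → toℕ i < parent cs i
parent-inflationary (cons 1≤c _ _) fzero    = 1≤c
parent-inflationary (cons _ _ cs)  (fsuc i) = s≤s (parent-inflationary cs i)

parent≤length : ∀ {cs} → IsProductKupisch cs → ∀ i → parent cs i ≤ length cs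
parent≤length (cons _ c≤1+d cs) fzero    = ≤-trans c≤1+d (s≤s (head₀≤length cs))
parent≤length (cons _ _ cs)     (fsuc i) = s≤s (parent≤length cs i)

parent-monotone : ∀ {cs} → IsProductKupisch cs →
                  ∀ a b → toℕ a ≤ toℕ b → parent cs a ≤ parent cs b
parent-monotone (cons _ _ _)                  fzero    fzero    _         = ≤-refl
parent-monotone {_ ∷ _ ∷ _} (cons _ c≤1+d cs) fzero    (fsuc b) _         =
  ≤-trans c≤1+d (s≤s (parent-monotone cs fzero b z≤n))
parent-monotone (cons _ _ cs)                 (fsuc a) (fsuc b) (s≤s a≤b) =
  s≤s (parent-monotone cs a b a≤b)

lemma3p4 : (n : ℕ) (A : 𝒜 n) → NaturallyLabeled n (τ-parent A)
lemma3p4 n A = monotone⇒naturallyLabeled (τ-parent A) bounded monotone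
  where
  open 𝒜 A
  cs : List ℕ
  cs = concat factors
  kupischCs : IsProductKupisch cs
  kupischCs = concat-isProductKupisch kupisch
  ι : Fin n → Fin (length cs)
  ι = cast (sym total)
  toℕ-ι : ∀ i → toℕ (ι i) ≡ toℕ i
  toℕ-ι = toℕ-cast (sym total)
  τ-parent≡parent : ∀ i → τ-parent A i ≡ parent cs (ι i)
  τ-parent≡parent i = cong (_+ lookup cs (ι i)) (sym (toℕ-ι i))

  bounded : ∀ i → toℕ i < τ-parent A i × τ-parent A i ≤ n
  bounded i =
    subst₂ _<_ (toℕ-ι i) (sym (τ-parent≡parent i)) (parent-inflationary kupischCs (ι i)) ,
    subst₂ _≤_ (sym (τ-parent≡parent i)) total (parent≤length kupischCs (ι i))
  monotone : ∀ a b → toℕ a ≤ toℕ b → τ-parent A a ≤ τ-parent A b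
  monotone a b a≤b =
    subst₂ _≤_ (sym (τ-parent≡parent a)) (sym (τ-parent≡parent b))
      (parent-monotone kupischCs (ι a) (ι b) (subst₂ _≤_ (sym (toℕ-ι a)) (sym (toℕ-ι b)) a≤b))
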